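{- Let $\mathbf{A}$ be a two-element lattice and $C=\mathrm{Clo}(\mathbf{A})$. Then the relational structure $(A;C^{\bullet})$ is not polymorphism-homogeneous.
   Context: The graph of an $n$-ary operation $f$ is $f^\bullet=\{(a_1,\dots,a_{n+1})\in A^{n+1}: f(a_1,\dots,a_n)=a_{n+1}\}$, and $C^\bullet=\{f^\bullet: f\in C\}$. A partial $k$-ary operation $h$ (domain $\mathrm{dom}\,h\subseteq A^k$) preserves $\rho\subseteq A^n$ if for every $n\times k$ matrix whose columns lie in $\rho$ and rows $r_1,\dots,r_n$ lie in $\mathrm{dom}\,h$, $(h(r_1),\dots,h(r_n))\in\rho$. A relational structure $(A;R)$ is polymorphism-homogeneous if for every $k\ge1$ every partial $k$-ary operation preserving all of $R$ extends to a total $k$-ary operation preserving all of $R$. -}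

module Defs where

open import Data.Nat using (ℕ; suc)
open import Data.Fin using (Fin; inject₁; fromℕ)
open import Data.Maybe using (Maybe; just)
open import Data.Product using (Σ; ∃; _×_; _,_)
open import Relation.Binary.PropositionalEquality using (_≡_)

Op : Set → ℕ → Set
Op A n = (Fin n → A) → A

RelOn : Set → ℕ → Set₁
RelOn A m = (Fin m → A) → Set

data Term (n : ℕ) : Set where
  var  : Fin n → Term n
  _∧ₜ_ : Term n → Term n → Term n
  _∨ₜ_ : Term n → Term n → Term n

module _ {A : Set} (_∧_ _∨_ : A → A → A) where

  eval : ∀ {n} → Term n → Op A n
  eval (var i)  x = x i
  eval (s ∧ₜ t) x = eval s x ∧ eval t x
  eval (s ∨ₜ t) x = eval s x ∨ eval t x

  InClo : ∀ {n} → Op A n → Set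
  InClo {n} f = ∃ λ (t : Term n) → ∀ x → f x ≡ eval t x

  CloIdx : Set
  CloIdx = Σ ℕ λ n → Σ (Op A n) InClo

graph : ∀ {A n} → Op A n → RelOn A (suc n)
graph {n = n} f a = f (λ i → a (inject₁ i)) ≡ a (fromℕ n)

-- C• as a relational structure indexed by CloIdx
CloArity : ∀ {A} (_∧_ _∨_ : A → A → A) → CloIdx _∧_ _∨_ → ℕ
CloArity _ _ (n , _) = suc n

CloRel : ∀ {A} (_∧_ _∨_ : A → A → A) → (i : CloIdx _∧_ _∨_) → RelOn A (CloArity _∧_ _∨_ i)
CloRel _ _ (n , f , _) = graph f

PartialOp : Set → ℕ → Set
PartialOp A k = (Fin k → A) → Maybe A

PartialPreserves : ∀ {A k m} → PartialOp A k → RelOn A m → Set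
PartialPreserves {A} {k} {m} h ρ =
  (M : Fin m → Fin k → A) (b : Fin m → A) →
  (∀ j → ρ (λ i → M i j)) →
  (∀ i → h (M i) ≡ just (b i)) →
  ρ b

Preserves : ∀ {A k m} → Op A k → RelOn A m → Set
Preserves {A} {k} {m} g ρ =
  (M : Fin m → Fin k → A) → (∀ j → ρ (λ i → M i j)) → ρ (λ i → g (M i))

Extends : ∀ {A k} → Op A k → PartialOp A k → Set
Extends g h = ∀ r b → h r ≡ just b → g r ≡ b

PolyHomogeneous : (A : Set) {I : Set} (ar : I → ℕ) (R : (i : I) → RelOn A (ar i)) → Set
PolyHomogeneous A {I} ar R =
  ∀ (k : ℕ) (h : PartialOp A (suc k)) →
  (∀ i → PartialPreserves h (R i)) →
  ∃ λ (g : Op A (suc k)) → Extends g h × (∀ i → Preserves g (R i))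

module Submission where

-- The argument works in every lattice with decidable equality and two distinct
-- elements.  Consider the partial 4-ary operation
--     h(x₀,x₁,x₂,x₃) = x₀ ∨ x₁    defined exactly when  x₀ ∨ x₁ = x₂ ∧ x₃.
-- (1) Every term operation of a lattice is monotone, and h preserves the graph
--     of every monotone operation: on a defined row, x₀,x₁ ≤ h(x) ≤ x₂,x₃, so
--     monotonicity squeezes the last row between x₀ ∨ x₁ and x₂ ∧ x₃.
-- (2) A total extension g of h that preserves the graphs of ∧ and ∨ forces
--     x = y whenever x ≤ y, because g(x,x,y,y) is computed as y by splitting
--     the argument with ∧ and as x by splitting it with ∨.
-- Applied to x ∧ y ≤ x ∨ y for distinct x, y, (2) contradicts (1) together
-- with polymorphism-homogeneity; a two-element set provides both decidable
-- equality and two distinct elements.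

open import Defs
open import Data.Fin using (Fin)
open import Function.Bundles using (_↔_)
open import Relation.Nullary using (¬_)
open import Relation.Binary.PropositionalEquality using (_≡_)
open import Algebra.Lattice.Structures using (IsLattice)

open import Data.Fin using (zero; suc; #_; inject₁; fromℕ)
import Data.Fin.Properties as Fin
open import Data.Vec.Functional using (_∷_; [])
open import Data.Maybe using (just; nothing)
open import Data.Product using (_×_; _,_; proj₁; proj₂)
open import Function.Bundles using (Inverse)
open import Function.Properties.Inverse using (↔⇒↣)
open import Relation.Nullary using (yes; no; contradiction)
open import Relation.Nullary.Decidable using (via-injection)
open import Relation.Binary.Definitions using (DecidableEquality)
open import Relation.Binary.PropositionalEquality using (_≢_; refl; sym; trans; cong; cong₂; subst; subst₂; module ≡-Reasoning)
import Algebra.Lattice.Properties.Lattice as AlgebraicLattice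
import Relation.Binary.Lattice as Order
import Relation.Binary.Lattice.Properties.Lattice as OrderLattice
import Relation.Binary.Lattice.Properties.JoinSemilattice as JoinProperties
import Relation.Binary.Lattice.Properties.MeetSemilattice as MeetProperties

module LatticeFacts {A : Set} (_∧_ _∨_ : A → A → A) (isLattice : IsLattice _≡_ _∨_ _∧_) where

  open IsLattice isLattice public using (∧-comm; ∨-comm)

  -- The lattice order x ≤ y ⇔ x ≡ x ∧ y with its standard properties.
  orderLattice : Order.Lattice _ _ _
  orderLattice = AlgebraicLattice.∨-∧-orderTheoreticLattice (record { isLattice = isLattice })

  open Order.Lattice orderLattice public
    using (_≤_; reflexive; antisym; x≤x∨y; y≤x∨y; x∧y≤x; x∧y≤y; ∨-least; ∧-greatest)
  open OrderLattice orderLattice public using (∧≤∨; collapse₂)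
  open JoinProperties (Order.Lattice.joinSemilattice orderLattice) public
    using (∨-monotonic; ∨-idempotent; x≤y⇒x∨y≈y)
  open MeetProperties (Order.Lattice.meetSemilattice orderLattice) public
    using (∧-monotonic; ∧-idempotent)

  Monotone : ∀ {n} → Op A n → Set
  Monotone f = ∀ {x y} → (∀ i → x i ≤ y i) → f x ≤ f y

  eval-monotone : ∀ {n} (t : Term n) → Monotone (eval _∧_ _∨_ t)
  eval-monotone (var i)  x≤y = x≤y i
  eval-monotone (s ∧ₜ t) x≤y = ∧-monotonic (eval-monotone s x≤y) (eval-monotone t x≤y)
  eval-monotone (s ∨ₜ t) x≤y = ∨-monotonic (eval-monotone s x≤y) (eval-monotone t x≤y)

  clone-monotone : ∀ {n} {f : Op A n} → InClo _∧_ _∨_ f → Monotone f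
  clone-monotone {f = f} (t , f≗t) {x} {y} x≤y =
    subst₂ _≤_ (sym (f≗t x)) (sym (f≗t y)) (eval-monotone t x≤y)

-- The counterexample to polymorphism-homogeneity, in any lattice with
-- decidable equality (needed to define the partial operation h).
module NotHomogeneous {A : Set} (_∧_ _∨_ : A → A → A) (isLattice : IsLattice _≡_ _∨_ _∧_)
                      (_≟_ : DecidableEquality A) where

  open LatticeFacts _∧_ _∨_ isLattice

  h : PartialOp A 4
  h x with (x (# 0) ∨ x (# 1)) ≟ (x (# 2) ∧ x (# 3))
  ... | yes _ = just (x (# 0) ∨ x (# 1))
  ... | no _  = nothing

  h-value : ∀ x {v} → h x ≡ just v → (x (# 0) ∨ x (# 1) ≡ v) × (x (# 2) ∧ x (# 3) ≡ v)
  h-value x hx≡v with (x (# 0) ∨ x (# 1)) ≟ (x (# 2) ∧ x (# 3)) | hx≡v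
  ... | yes join≡meet | refl = refl , sym join≡meet

  h-defined : ∀ x {v} → x (# 0) ∨ x (# 1) ≡ v → x (# 2) ∧ x (# 3) ≡ v → h x ≡ just v
  h-defined x join≡v meet≡v with (x (# 0) ∨ x (# 1)) ≟ (x (# 2) ∧ x (# 3))
  ... | yes _        = cong just join≡v
  ... | no join≢meet = contradiction (trans join≡v (sym meet≡v)) join≢meet

  h-below : ∀ x {v} → h x ≡ just v → x (# 0) ≤ v × x (# 1) ≤ v
  h-below x hx≡v with h-value x hx≡v
  ... | refl , _ = x≤x∨y _ _ , y≤x∨y _ _

  h-above : ∀ x {v} → h x ≡ just v → v ≤ x (# 2) × v ≤ x (# 3)
  h-above x hx≡v with h-value x hx≡v
  ... | _ , refl = x∧y≤x _ _ , x∧y≤y _ _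

  h-preserves-monotone : ∀ {n} {f : Op A n} → Monotone f → PartialPreserves h (graph f)
  h-preserves-monotone {n} {f} mono M b columns hM≡b =
    antisym f-below-last last-below-f
    where
    last = fromℕ n
    inputs : Fin n → A
    inputs i = b (inject₁ i)

    column-below : ∀ j → (∀ i → M i j ≤ b i) → M last j ≤ f inputs
    column-below j M≤b = subst (_≤ f inputs) (columns j) (mono (λ i → M≤b (inject₁ i)))

    column-above : ∀ j → (∀ i → b i ≤ M i j) → f inputs ≤ M last j
    column-above j b≤M = subst (f inputs ≤_) (columns j) (mono (λ i → b≤M (inject₁ i)))

    last-below-f : b last ≤ f inputs
    last-below-f = subst (_≤ f inputs) (proj₁ (h-value (M last) (hM≡b last)))
      (∨-least (column-below (# 0) (λ i → proj₁ (h-below (M i) (hM≡b i))))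
               (column-below (# 1) (λ i → proj₂ (h-below (M i) (hM≡b i)))))

    f-below-last : f inputs ≤ b last
    f-below-last = subst (f inputs ≤_) (proj₂ (h-value (M last) (hM≡b last)))
      (∧-greatest (column-above (# 2) (λ i → proj₁ (h-above (M i) (hM≡b i))))
                  (column-above (# 3) (λ i → proj₂ (h-above (M i) (hM≡b i)))))

  h-preserves-clone : ∀ i → PartialPreserves h (CloRel _∧_ _∨_ i)
  h-preserves-clone (n , f , f∈C) = h-preserves-monotone (clone-monotone f∈C)

  meet₂ join₂ : Op A 2
  meet₂ x = x (# 0) ∧ x (# 1)
  join₂ x = x (# 0) ∨ x (# 1)

  meet-in-clone join-in-clone : CloIdx _∧_ _∨_
  meet-in-clone = 2 , meet₂ , var (# 0) ∧ₜ var (# 1) , λ _ → refl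
  join-in-clone = 2 , join₂ , var (# 0) ∨ₜ var (# 1) , λ _ → refl

  -- A total extension of h preserving the graphs of ∧ and ∨ identifies any
  -- comparable elements: g(x,x,y,y) equals y via ∧ and x via ∨.
  extension-collapses : ∀ {g : Op A 4} → Extends g h →
                        Preserves g (graph meet₂) → Preserves g (graph join₂) →
                        ∀ {x y} → x ≤ y → x ≡ y
  extension-collapses {g} g⊇h g-meet g-join {x} {y} x≤y = begin
    x               ≡⟨ sym x∨x≡x ⟩
    x ∨ x           ≡⟨ cong₂ _∨_ (sym (g-on xxxy x∨x≡x (sym x≤y))) (sym (g-on xxyx x∨x≡x y∧x≡x)) ⟩
    g xxxy ∨ g xxyx ≡⟨ g-join (xxxy ∷ xxyx ∷ xxyy ∷ []) join-columns ⟩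
    g xxyy          ≡⟨ sym (g-meet (xyyy ∷ yxyy ∷ xxyy ∷ []) meet-columns) ⟩
    g xyyy ∧ g yxyy ≡⟨ cong₂ _∧_ (g-on xyyy x∨y≡y y∧y≡y) (g-on yxyy y∨x≡y y∧y≡y) ⟩
    y ∧ y           ≡⟨ y∧y≡y ⟩
    y               ∎
    where
    open ≡-Reasoning
    xxxy xxyx xxyy xyyy yxyy : Fin 4 → A
    xxxy = x ∷ x ∷ x ∷ y ∷ []
    xxyx = x ∷ x ∷ y ∷ x ∷ []
    xxyy = x ∷ x ∷ y ∷ y ∷ []
    xyyy = x ∷ y ∷ y ∷ y ∷ []
    yxyy = y ∷ x ∷ y ∷ y ∷ []

    g-on : ∀ r {v} → r (# 0) ∨ r (# 1) ≡ v → r (# 2) ∧ r (# 3) ≡ v → g r ≡ v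
    g-on r join≡v meet≡v = g⊇h r _ (h-defined r join≡v meet≡v)

    x∨x≡x : x ∨ x ≡ x
    x∨x≡x = ∨-idempotent x
    y∧y≡y : y ∧ y ≡ y
    y∧y≡y = ∧-idempotent y
    x∨y≡y : x ∨ y ≡ y
    x∨y≡y = x≤y⇒x∨y≈y x≤y
    y∨x≡y : y ∨ x ≡ y
    y∨x≡y = trans (∨-comm y x) x∨y≡y
    y∧x≡x : y ∧ x ≡ x
    y∧x≡x = trans (∧-comm y x) (sym x≤y)

    join-columns : ∀ j → graph join₂ (λ i → (xxxy ∷ xxyx ∷ xxyy ∷ []) i j)
    join-columns zero                   = x∨x≡x
    join-columns (suc zero)             = x∨x≡x
    join-columns (suc (suc zero))       = x∨y≡y
    join-columns (suc (suc (suc zero))) = y∨x≡y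

    meet-columns : ∀ j → graph meet₂ (λ i → (xyyy ∷ yxyy ∷ xxyy ∷ []) i j)
    meet-columns zero                   = sym x≤y
    meet-columns (suc zero)             = y∧x≡x
    meet-columns (suc (suc zero))       = y∧y≡y
    meet-columns (suc (suc (suc zero))) = y∧y≡y

  not-homogeneous : ∀ {x y} → x ≢ y → ¬ PolyHomogeneous A (CloArity _∧_ _∨_) (CloRel _∧_ _∨_)
  not-homogeneous x≢y homogeneous with homogeneous 3 h h-preserves-clone
  ... | g , g⊇h , g-preserves =
    x≢y (collapse₂ (reflexive (sym (extension-collapses g⊇h
      (g-preserves meet-in-clone) (g-preserves join-in-clone) ∧≤∨))))

module TwoElements {A : Set} (A↔2 : A ↔ Fin 2) where

  open Inverse A↔2

  _≟_ : DecidableEquality A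
  _≟_ = via-injection (↔⇒↣ A↔2) Fin._≟_

  from-distinct : from zero ≢ from (suc zero)
  from-distinct eq with trans (sym (strictlyInverseˡ zero)) (trans (cong to eq) (strictlyInverseˡ (suc zero)))
  ... | ()

lemma4p5 : (A : Set) (_∧_ _∨_ : A → A → A) →
           IsLattice _≡_ _∨_ _∧_ →
           A ↔ Fin 2 →
           ¬ PolyHomogeneous A (CloArity _∧_ _∨_) (CloRel _∧_ _∨_)
lemma4p5 A _∧_ _∨_ isLattice A↔2 =
  NotHomogeneous.not-homogeneous _∧_ _∨_ isLattice _≟_ from-distinct
  where open TwoElements A↔2
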